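{- For all integers $n\ge 0$, \[ a^{ -\{1\}}_{4,1}(n)\ge a^{ -\{1\}}_{4,3}(n). \]
   Context: A partition of $n$ is a non-increasing sequence of positive integers summing to $n$; its Young diagram is the left-justified array of boxes whose $i$-th row has $\lambda_i$ boxes. The hook length of a box is the number of boxes directly to its right, plus the number directly below it, plus $1$; a box of hook length $k$ is a $k$-hook. For $t\ge 2$, a $t$-core partition is a partition none of whose hook lengths is divisible by $t$. For a set $C$ of positive integers, $a^{ -C}_{t,k}(n)$ denotes the total number of hooks of length $k$ summed over all $t$-core partitions of $n$ none of whose parts belongs to $C$. -}

module Defs where

open import Data.Nat using (ℕ; zero; suc; _+_; _∸_; _≤ᵇ_; _<ᵇ_; _≡ᵇ_; _%_)
open import Data.Bool using (Bool; true; false; not; _∧_; if_then_else_)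
open import Data.List using (List; []; _∷_; map; concatMap; length; filter; upTo)
open import Data.Bool.ListAction using (all; any)
open import Data.Nat.ListAction using (sum)
open import Relation.Nullary.Decidable using (does)
open import Data.Nat.Divisibility using (_∣?_)

-- Partitions of n, listed as non-increasing lists of positive parts.
-- partitionsBounded fuel m n : all partitions of n with every part ≤ m
-- (complete as long as fuel ≥ n, since each part is ≥ 1).

partitionsBounded : ℕ → ℕ → ℕ → List (List ℕ)
partitionsBounded fuel m zero = [] ∷ []
partitionsBounded zero m (suc n) = []
partitionsBounded (suc fuel) m (suc n) =
  concatMap
    (λ k → map (k ∷_) (partitionsBounded fuel k (suc n ∸ k)))
    (filter (λ k → Data.Nat._≤?_ k m) (map suc (upTo (suc n))))

partitions : ℕ → List (List ℕ)
partitions n = partitionsBounded n n n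

-- Hook lengths.  Rows and columns are 0-indexed.

colLength : List ℕ → ℕ → ℕ
colLength ν j = length (filter (λ p → Data.Nat._<?_ j p) ν)

-- hook length of box (i , j) in a row of length r:
-- arm = r - j - 1, leg = λ'_j - i - 1, hook = arm + leg + 1
hooksOfRows : List ℕ → ℕ → List ℕ → List ℕ
hooksOfRows ν i [] = []
hooksOfRows ν i (r ∷ rs) =
  map (λ j → suc ((r ∸ suc j) + (colLength ν j ∸ suc i))) (upTo r)
  Data.List.++ hooksOfRows ν (suc i) rs

hookLengths : List ℕ → List ℕ
hookLengths ν = hooksOfRows ν 0 ν

numHooks : ℕ → List ℕ → ℕ
numHooks k ν = length (filter (λ h → Data.Nat._≟_ h k) (hookLengths ν))

isCore : ℕ → List ℕ → Bool
isCore t ν = all (λ h → not (does (t ∣? h))) (hookLengths ν)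

avoids : List ℕ → List ℕ → Bool
avoids C ν = all (λ p → not (any (λ c → does (Data.Nat._≟_ p c)) C)) ν

-- a^{-C}_{t,k}(n): total number of k-hooks over all t-core partitions of n
-- having no part in C
a : List ℕ → ℕ → ℕ → ℕ → ℕ
a C t k n =
  sum (map (numHooks k)
           (filter (λ μ → Data.Bool._≟_ (isCore t μ ∧ avoids C μ) true)
                   (partitions n)))

{-# OPTIONS --safe #-}
module Submission where

-- Peel off the first row.  A hook of length k ≤ 4 in the first row sits in one of its
-- last four boxes, and its leg is read off the first four gaps λ₁ - λ₂, …, λ₄ - λ₅
-- (parts beyond the length count as 0).  A 4-core has no 4-hook, which forces every gap
-- to be at most 3, so the first row contributes one of 4⁴ possible patterns.  For the
-- potential Φ(λ) = [λ₁ - λ₂ = 2] + [λ₁ - λ₃ = 1] a check of these patterns gives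
--   Φ(λ) + #3-hooks in row 1 ≤ #1-hooks in row 1 + Φ(λ without its first row),
-- and summing over the rows gives #3-hooks ≤ #1-hooks for every 4-core.

open import Defs
open import Data.Nat
  using (ℕ; zero; suc; _+_; _∸_; _⊓_; _≤_; _<_; _≥_; z≤n; s≤s; z<s; s<s; _≟_; _≤?_; _<?_; allUpTo?)
open import Data.Nat.Properties
open import Data.Nat.Divisibility using (_∣?_; ∣-refl)
open import Data.Nat.ListAction using (sum)
open import Data.Bool using (T; true; _∧_; not)
import Data.Bool as Bool
open import Data.Bool.Properties using (T-≡; T-∧)
open import Data.List
  using (List; []; _∷_; [_]; _++_; map; filter; length; upTo; applyUpTo; applyDownFrom; reverse)
open import Data.List.Properties
  using (filter-++; length-++; filter-accept; filter-none; map-upTo; map-cong-local;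
         reverse-applyUpTo; length-applyUpTo)
open import Data.List.Relation.Unary.All as All using (All; []; _∷_)
open import Data.List.Relation.Unary.All.Properties
  using (all⁺; all-anti-mono; applyUpTo⁺₁; applyUpTo⁺₂; all-filter; filter⁺; map⁺; concat⁺)
open import Data.List.Membership.Propositional.Properties using (∈-++⁺ʳ)
open import Data.Bool.ListAction using (all)
open import Data.List.Relation.Unary.AllPairs using (AllPairs; []; _∷_)
open import Data.List.Relation.Binary.Permutation.Propositional.Properties
  using (↭-length; filter-↭; ↭-reverse)
open import Data.Product using (_×_; _,_; proj₁)
open import Function using (_∘_; id; Equivalence)
open import Relation.Nullary using (Dec; yes; no; does; contradiction)
open import Relation.Nullary.Decidable using (from-yes; _→-dec_)
open import Relation.Binary.PropositionalEquality hiding ([_])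

private
  variable
    k r w x i j : ℕ
    xs rs : List ℕ

count : ℕ → List ℕ → ℕ
count k = length ∘ filter (_≟ k)

count-++ : ∀ k xs ys → count k (xs ++ ys) ≡ count k xs + count k ys
count-++ k xs ys = trans (cong length (filter-++ (_≟ k) xs ys)) (length-++ (filter (_≟ k) xs))

count-∷ : ∀ k x xs → count k (x ∷ xs) ≡ count k [ x ] + count k xs
count-∷ k x = count-++ k [ x ]

count-reverse : ∀ k xs → count k (reverse xs) ≡ count k xs
count-reverse k xs = ↭-length (filter-↭ (_≟ k) (↭-reverse xs))

count-none : All (_≢ k) xs → count k xs ≡ 0
count-none {k} xs≢k = cong length (filter-none (_≟ k) xs≢k)

count-singleton-< : k < x → count k [ x ] ≡ 0
count-singleton-< k<x = count-none (>⇒≢ k<x ∷ [])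

applyDownFrom-reflect : ∀ (f : ℕ → ℕ) n → applyDownFrom f n ≡ applyUpTo (λ i → f (n ∸ suc i)) n
applyDownFrom-reflect f zero    = refl
applyDownFrom-reflect f (suc n) = cong (f n ∷_) (applyDownFrom-reflect f n)

count-applyUpTo-reflect : ∀ k f n → count k (applyUpTo f n) ≡ count k (applyUpTo (λ i → f (n ∸ suc i)) n)
count-applyUpTo-reflect k f n = begin
  count k (applyUpTo f n)                         ≡⟨ count-reverse k (applyUpTo f n) ⟨
  count k (reverse (applyUpTo f n))               ≡⟨ cong (count k) (reverse-applyUpTo f n) ⟩
  count k (applyDownFrom f n)                     ≡⟨ cong (count k) (applyDownFrom-reflect f n) ⟩
  count k (applyUpTo (λ i → f (n ∸ suc i)) n)     ∎
  where open ≡-Reasoning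

count-applyUpTo-cong : ∀ {f g : ℕ → ℕ} n → (∀ {i} → i < n → count k [ f i ] ≡ count k [ g i ]) →
                       count k (applyUpTo f n) ≡ count k (applyUpTo g n)
count-applyUpTo-cong             zero    f≈g = refl
count-applyUpTo-cong {k} {f} {g} (suc n) f≈g = begin
  count k (applyUpTo f (suc n))                            ≡⟨ count-∷ k (f 0) (applyUpTo (f ∘ suc) n) ⟩
  count k [ f 0 ] + count k (applyUpTo (f ∘ suc) n)        ≡⟨ cong₂ _+_ (f≈g z<s) (count-applyUpTo-cong n (f≈g ∘ s<s)) ⟩
  count k [ g 0 ] + count k (applyUpTo (g ∘ suc) n)        ≡⟨ count-∷ k (g 0) (applyUpTo (g ∘ suc) n) ⟨
  count k (applyUpTo g (suc n))                            ∎
  where open ≡-Reasoning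

count-applyUpTo-cutoff : ∀ {f : ℕ → ℕ} m n → (∀ {i} → m ≤ i → f i ≢ k) → (∀ {i} → n ≤ i → f i ≢ k) →
                         count k (applyUpTo f m) ≡ count k (applyUpTo f n)
count-applyUpTo-cutoff {f = f} zero n f≢k _ = sym (count-none (applyUpTo⁺₂ f n (λ _ → f≢k z≤n)))
count-applyUpTo-cutoff {f = f} (suc m) zero _ f≢k = count-none (applyUpTo⁺₂ f (suc m) (λ _ → f≢k z≤n))
count-applyUpTo-cutoff {k} {f} (suc m) (suc n) f≢kₘ f≢kₙ = begin
  count k (applyUpTo f (suc m))                        ≡⟨ count-∷ k (f 0) (applyUpTo (f ∘ suc) m) ⟩
  count k [ f 0 ] + count k (applyUpTo (f ∘ suc) m)    ≡⟨ cong (count k [ f 0 ] +_) tails ⟩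
  count k [ f 0 ] + count k (applyUpTo (f ∘ suc) n)    ≡⟨ count-∷ k (f 0) (applyUpTo (f ∘ suc) n) ⟨
  count k (applyUpTo f (suc n))                        ∎
  where
  open ≡-Reasoning
  tails = count-applyUpTo-cutoff m n (f≢kₘ ∘ s≤s) (f≢kₙ ∘ s≤s)

sum-map-mono : ∀ {A : Set} {f g : A → ℕ} {xs : List A} →
               All (λ x → f x ≤ g x) xs → sum (map f xs) ≤ sum (map g xs)
sum-map-mono []          = z≤n
sum-map-mono (fx≤gx ∷ p) = +-mono-≤ fx≤gx (sum-map-mono p)

part : List ℕ → ℕ → ℕ
part []       _       = 0
part (x ∷ _)  zero    = x
part (_ ∷ xs) (suc i) = part xs i

gap : List ℕ → ℕ → ℕ
gap ν i = part ν i ∸ part ν (suc i)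

gaps : ℕ → List ℕ → List ℕ
gaps w ν = applyUpTo (gap ν) w

part₀-≤ : All (_≤ x) xs → part xs 0 ≤ x
part₀-≤ []          = z≤n
part₀-≤ (x₀≤x ∷ _)  = x₀≤x

sum-gaps-≤ : ∀ {ν} → AllPairs _≥_ ν → ∀ w → sum (gaps w ν) ≤ part ν 0
sum-gaps-≤ _                   zero    = z≤n
sum-gaps-≤ []                  (suc w) = sum-gaps-≤ [] w
sum-gaps-≤ {x ∷ xs} (x≥xs ∷ xs↓) (suc w) = begin
  (x ∸ part xs 0) + sum (gaps w xs)   ≤⟨ +-monoʳ-≤ (x ∸ part xs 0) (sum-gaps-≤ xs↓ w) ⟩
  (x ∸ part xs 0) + part xs 0         ≡⟨ m∸n+n≡m (part₀-≤ x≥xs) ⟩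
  x                                   ∎
  where open ≤-Reasoning

-- The leg of the box with arm i in the top row of a partition with gaps d ∷ ds: the
-- next row reaches below that box iff d ≤ i, and then the box has arm i - d relative
-- to the next row.
legOf : List ℕ → ℕ → ℕ
legOf []       i = 0
legOf (d ∷ ds) i with d ≤? i
... | yes _ = suc (legOf ds (i ∸ d))
... | no  _ = 0

armHooks : ℕ → List ℕ → List ℕ
armHooks w ds = applyUpTo (λ i → suc (i + legOf ds i)) w

legOf-∷-≤ : ∀ {d} ds → d ≤ i → legOf (d ∷ ds) i ≡ suc (legOf ds (i ∸ d))
legOf-∷-≤ {i} {d} ds d≤i with d ≤? i
... | yes _   = refl
... | no  d≰i = contradiction d≤i d≰i

legOf-∷-> : ∀ {d} ds → i < d → legOf (d ∷ ds) i ≡ 0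
legOf-∷-> {i} {d} ds i<d with d ≤? i
... | yes d≤i = contradiction d≤i (<⇒≱ i<d)
... | no  _   = refl

legOf-sum-≤ : ∀ ds → sum ds ≤ i → legOf ds i ≡ length ds
legOf-sum-≤     []       _       = refl
legOf-sum-≤ {i} (d ∷ ds) d+ds≤i = begin
  legOf (d ∷ ds) i          ≡⟨ legOf-∷-≤ ds (≤-trans (m≤m+n d (sum ds)) d+ds≤i) ⟩
  suc (legOf ds (i ∸ d))    ≡⟨ cong suc (legOf-sum-≤ ds (m+n≤o⇒n≤o∸m d d+ds≤i)) ⟩
  suc (length ds)           ∎
  where
  open ≡-Reasoning
  m+n≤o⇒n≤o∸m : ∀ m {n o} → m + n ≤ o → n ≤ o ∸ m
  m+n≤o⇒n≤o∸m m {n} {o} le = m+n≤o⇒m≤o∸n n (subst (_≤ o) (+-comm m n) le)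

firstRowHook : ℕ → List ℕ → ℕ → ℕ
firstRowHook r rs j = suc ((r ∸ suc j) + colLength rs j)

colLength-∷-< : ∀ rs → j < r → colLength (r ∷ rs) j ≡ suc (colLength rs j)
colLength-∷-< {j} rs j<r = cong length (filter-accept (j <?_) j<r)

colLength-≤ : All (_≤ j) xs → colLength xs j ≡ 0
colLength-≤ {j} xs≤j = cong length (filter-none (j <?_) (All.map ≤⇒≯ xs≤j))

hooksOfRows-∷ : ∀ rs i → All (_≤ r) xs → hooksOfRows (r ∷ rs) (suc i) xs ≡ hooksOfRows rs i xs
hooksOfRows-∷ rs i [] = refl
hooksOfRows-∷ {r} {x ∷ _} rs i (x≤r ∷ xs≤r) = cong₂ _++_ row (hooksOfRows-∷ rs (suc i) xs≤r)
  where
  row = map-cong-local (applyUpTo⁺₁ id x λ {j} j<x →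
          cong (λ c → suc ((x ∸ suc j) + (c ∸ suc (suc i)))) (colLength-∷-< rs (<-≤-trans j<x x≤r)))

hookLengths-∷ : AllPairs _≥_ (r ∷ rs) → hookLengths (r ∷ rs) ≡ map (firstRowHook r rs) (upTo r) ++ hookLengths rs
hookLengths-∷ {r} {rs} (r≥rs ∷ _) = cong₂ _++_ firstRow (hooksOfRows-∷ rs 0 r≥rs)
  where
  firstRow = map-cong-local (applyUpTo⁺₁ id r λ {j} j<r →
               cong (λ c → suc ((r ∸ suc j) + (c ∸ 1))) (colLength-∷-< rs j<r))

colLength-⊓-legOf : AllPairs _≥_ (r ∷ rs) → i + suc j ≡ r →
                    ∀ w → colLength rs j ⊓ w ≡ legOf (gaps w (r ∷ rs)) i
colLength-⊓-legOf {rs = rs} {j = j} _ _ zero = ⊓-zeroʳ (colLength rs j)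
colLength-⊓-legOf {rs = []} {i} _ refl (suc w) = sym (legOf-∷-> _ (m<m+n i z<s))
colLength-⊓-legOf {r} {y ∷ ys} {i} {j} ((y≤r ∷ _) ∷ y∷ys↓@(y≥ys ∷ _)) i+1+j≡r (suc w) with j <? y
... | yes j<y = begin
  colLength (y ∷ ys) j ⊓ suc w                  ≡⟨ cong (_⊓ suc w) (colLength-∷-< ys j<y) ⟩
  suc (colLength ys j ⊓ w)                      ≡⟨ cong suc (colLength-⊓-legOf y∷ys↓ arm-below w) ⟩
  suc (legOf (gaps w (y ∷ ys)) (i ∸ (r ∸ y)))   ≡⟨ legOf-∷-≤ (gaps w (y ∷ ys)) r∸y≤i ⟨
  legOf (gaps (suc w) (r ∷ y ∷ ys)) i           ∎
  where
  open ≡-Reasoning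
  r∸y≤i : r ∸ y ≤ i
  r∸y≤i = m≤n+o⇒m∸n≤o r y (subst (_≤ y + i) i+1+j≡r (subst (i + suc j ≤_) (+-comm i y) (+-monoʳ-≤ i j<y)))
  arm-below : (i ∸ (r ∸ y)) + suc j ≡ y
  arm-below = begin
    (i ∸ (r ∸ y)) + suc j     ≡⟨ +-∸-comm (suc j) r∸y≤i ⟨
    (i + suc j) ∸ (r ∸ y)     ≡⟨ cong (_∸ (r ∸ y)) i+1+j≡r ⟩
    r ∸ (r ∸ y)               ≡⟨ m∸[m∸n]≡n y≤r ⟩
    y                         ∎
... | no j≮y = begin
  colLength (y ∷ ys) j ⊓ suc w                  ≡⟨ cong (_⊓ suc w) (colLength-≤ (y≤j ∷ ys≤j)) ⟩
  0                                             ≡⟨ legOf-∷-> (gaps w (y ∷ ys)) i<r∸y ⟨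
  legOf (gaps (suc w) (r ∷ y ∷ ys)) i           ∎
  where
  open ≡-Reasoning
  y≤j = ≮⇒≥ j≮y
  ys≤j = All.map (λ z≤y → ≤-trans z≤y y≤j) y≥ys
  r∸j≡1+i : r ∸ j ≡ suc i
  r∸j≡1+i = begin
    r ∸ j           ≡⟨ cong (_∸ j) i+1+j≡r ⟨
    (i + suc j) ∸ j ≡⟨ cong (_∸ j) (+-suc i j) ⟩
    suc i + j ∸ j   ≡⟨ m+n∸n≡m (suc i) j ⟩
    suc i           ∎
  i<r∸y : i < r ∸ y
  i<r∸y = <-≤-trans (≤-reflexive (sym r∸j≡1+i)) (∸-monoʳ-≤ r y≤j)

count-hook-⊓ : k ≤ w → ∀ i l → count k [ suc (i + l) ] ≡ count k [ suc (i + l ⊓ w) ]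
count-hook-⊓ {k} {w} k≤w i l with l ≤? w
... | yes l≤w = cong (λ l′ → count k [ suc (i + l′) ]) (sym (m≤n⇒m⊓n≡m l≤w))
... | no  l≰w = trans (count-singleton-< (s≤s (≤-trans k≤w (≤-trans w≤l (m≤n+m l i)))))
                      (sym (count-singleton-< (s≤s (≤-trans k≤w (≤-trans (≤-reflexive (sym l⊓w≡w)) (m≤n+m _ i))))))
  where
  w≤l = <⇒≤ (≰⇒> l≰w)
  l⊓w≡w = m≥n⇒m⊓n≡n w≤l

count-firstRow : AllPairs _≥_ (r ∷ rs) → k ≤ w →
                 count k (map (firstRowHook r rs) (upTo r)) ≡ count k (armHooks w (gaps w (r ∷ rs)))
count-firstRow {r} {rs} {k} {w} ν↓ k≤w = begin
  count k (map (firstRowHook r rs) (upTo r))                    ≡⟨ cong (count k) (map-upTo (firstRowHook r rs) r) ⟩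
  count k (applyUpTo (firstRowHook r rs) r)                     ≡⟨ count-applyUpTo-reflect k (firstRowHook r rs) r ⟩
  count k (applyUpTo (λ i → firstRowHook r rs (r ∸ suc i)) r)   ≡⟨ count-applyUpTo-cong r same-count ⟩
  count k (applyUpTo hook r)                                    ≡⟨ count-applyUpTo-cutoff r w beyond-r beyond-w ⟩
  count k (applyUpTo hook w)                                    ∎
  where
  open ≡-Reasoning
  ds = gaps w (r ∷ rs)
  hook : ℕ → ℕ
  hook i = suc (i + legOf ds i)

  same-count : ∀ {i} → i < r → count k [ firstRowHook r rs (r ∸ suc i) ] ≡ count k [ hook i ]
  same-count {i} i<r = begin
    count k [ suc ((r ∸ suc col) + colLength rs col) ]  ≡⟨ cong (λ arm → count k [ suc (arm + colLength rs col) ]) arm≡i ⟩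
    count k [ suc (i + colLength rs col) ]              ≡⟨ count-hook-⊓ k≤w i (colLength rs col) ⟩
    count k [ suc (i + colLength rs col ⊓ w) ]          ≡⟨ cong (λ l → count k [ suc (i + l) ]) leg≡ ⟩
    count k [ hook i ]                                  ∎
    where
    col = r ∸ suc i
    i+1+col≡r : i + suc col ≡ r
    i+1+col≡r = trans (+-suc i col) (m+[n∸m]≡n i<r)
    arm≡i : r ∸ suc col ≡ i
    arm≡i = trans (cong (_∸ suc col) (sym i+1+col≡r)) (m+n∸n≡m i (suc col))
    leg≡ : colLength rs col ⊓ w ≡ legOf ds i
    leg≡ = colLength-⊓-legOf ν↓ i+1+col≡r w

  -- Arms i ≥ r are not in the row; there all w padded gaps are ≤ i, so the leg is w.
  beyond-r : ∀ {i} → r ≤ i → hook i ≢ k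
  beyond-r {i} r≤i = >⇒≢ (s≤s (≤-trans k≤w (≤-trans (≤-reflexive (sym leg≡w)) (m≤n+m _ i))))
    where
    leg≡w : legOf ds i ≡ w
    leg≡w = trans (legOf-sum-≤ ds (≤-trans (sum-gaps-≤ ν↓ w) r≤i)) (length-applyUpTo (gap (r ∷ rs)) w)

  beyond-w : ∀ {i} → w ≤ i → hook i ≢ k
  beyond-w {i} w≤i = >⇒≢ (s≤s (≤-trans k≤w (≤-trans w≤i (m≤m+n i _))))

numHooks-∷ : AllPairs _≥_ (r ∷ rs) → k ≤ w →
             numHooks k (r ∷ rs) ≡ count k (armHooks w (gaps w (r ∷ rs))) + numHooks k rs
numHooks-∷ {r} {rs} {k} {w} ν↓ k≤w = begin
  count k (hookLengths (r ∷ rs))                                    ≡⟨ cong (count k) (hookLengths-∷ ν↓) ⟩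
  count k (map (firstRowHook r rs) (upTo r) ++ hookLengths rs)      ≡⟨ count-++ k (map (firstRowHook r rs) (upTo r)) (hookLengths rs) ⟩
  count k (map (firstRowHook r rs) (upTo r)) + numHooks k rs        ≡⟨ cong (_+ numHooks k rs) (count-firstRow ν↓ k≤w) ⟩
  count k (armHooks w (gaps w (r ∷ rs))) + numHooks k rs            ∎
  where open ≡-Reasoning

isCore-∷⁻ : ∀ t → AllPairs _≥_ (r ∷ rs) → T (isCore t (r ∷ rs)) → T (isCore t rs)
isCore-∷⁻ {r} {rs} t ν↓ =
  all-anti-mono (λ h → not (does (t ∣? h))) (∈-++⁺ʳ (map (firstRowHook r rs) (upTo r)))
  ∘ subst (T ∘ all (λ h → not (does (t ∣? h)))) (hookLengths-∷ ν↓)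

numHooks-core : ∀ t ν → T (isCore t ν) → numHooks t ν ≡ 0
numHooks-core t ν core = count-none (All.map t∤h⇒h≢t (all⁺ (λ h → not (does (t ∣? h))) (hookLengths ν) core))
  where
  t∤h⇒h≢t : ∀ {h} → T (not (does (t ∣? h))) → h ≢ t
  t∤h⇒h≢t t∤h refl with t ∣? t
  ... | yes _   = t∤h
  ... | no  t∤t = t∤t ∣-refl

no-4-armHook : AllPairs _≥_ (r ∷ rs) → T (isCore 4 (r ∷ rs)) → count 4 (armHooks 4 (gaps 4 (r ∷ rs))) ≡ 0
no-4-armHook {r} {rs} ν↓ core =
  m+n≡0⇒m≡0 _ (trans (sym (numHooks-∷ ν↓ ≤-refl)) (numHooks-core 4 (r ∷ rs) core))

head-<-4 : ∀ d ds → count 4 (armHooks 4 (d ∷ ds)) ≡ 0 → d < 4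
head-<-4 0 _ _ = s≤s z≤n
head-<-4 1 _ _ = s≤s (s≤s z≤n)
head-<-4 2 _ _ = s≤s (s≤s (s≤s z≤n))
head-<-4 3 _ _ = s≤s (s≤s (s≤s (s≤s z≤n)))
head-<-4 (suc (suc (suc (suc _)))) _ ()

gap-<-4 : ∀ {ν} → AllPairs _≥_ ν → T (isCore 4 ν) → ∀ i → gap ν i < 4
gap-<-4 []           _    _       = s≤s z≤n
gap-<-4 ν↓@(_ ∷ _)   core zero    = head-<-4 _ _ (no-4-armHook ν↓ core)
gap-<-4 ν↓@(_ ∷ rs↓) core (suc i) = gap-<-4 rs↓ (isCore-∷⁻ 4 ν↓ core) i

-- The least function of the first two gaps for which stepInequality holds: a
-- longest-path potential on the graph of gap windows.
potential : ℕ → ℕ → ℕ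
potential 2 _ = 1
potential 0 1 = 1
potential 1 0 = 1
potential _ _ = 0

StepInequality : ℕ → ℕ → ℕ → ℕ → Set
StepInequality d₀ d₁ d₂ d₃ = count 4 hs ≡ 0 → potential d₀ d₁ + count 3 hs ≤ count 1 hs + potential d₁ d₂
  where hs = armHooks 4 (d₀ ∷ d₁ ∷ d₂ ∷ d₃ ∷ [])

stepInequality : ∀ {d₀} → d₀ < 4 → ∀ {d₁} → d₁ < 4 → ∀ {d₂} → d₂ < 4 → ∀ {d₃} → d₃ < 4 →
                 StepInequality d₀ d₁ d₂ d₃
stepInequality = from-yes (allUpTo? (λ d₀ → allUpTo? (λ d₁ → allUpTo? (λ d₂ → allUpTo? (step? d₀ d₁ d₂) 4) 4) 4) 4)
  where
  step? : ∀ d₀ d₁ d₂ d₃ → Dec (StepInequality d₀ d₁ d₂ d₃)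
  step? d₀ d₁ d₂ d₃ = (count 4 hs ≟ 0) →-dec (potential d₀ d₁ + count 3 hs ≤? count 1 hs + potential d₁ d₂)
    where hs = armHooks 4 (d₀ ∷ d₁ ∷ d₂ ∷ d₃ ∷ [])

hookBias : ∀ {ν} → AllPairs _≥_ ν → T (isCore 4 ν) →
           potential (gap ν 0) (gap ν 1) + numHooks 3 ν ≤ numHooks 1 ν
hookBias []                     _    = z≤n
hookBias {r ∷ rs} ν↓@(_ ∷ rs↓) core = begin
  Φ + numHooks 3 (r ∷ rs)          ≡⟨ cong (Φ +_) (numHooks-∷ ν↓ 3≤4) ⟩
  Φ + (window 3 + numHooks 3 rs)   ≡⟨ +-assoc Φ (window 3) (numHooks 3 rs) ⟨
  (Φ + window 3) + numHooks 3 rs   ≤⟨ +-monoˡ-≤ (numHooks 3 rs) step ⟩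
  (window 1 + Φ′) + numHooks 3 rs  ≡⟨ +-assoc (window 1) Φ′ (numHooks 3 rs) ⟩
  window 1 + (Φ′ + numHooks 3 rs)  ≤⟨ +-monoʳ-≤ (window 1) (hookBias rs↓ (isCore-∷⁻ 4 ν↓ core)) ⟩
  window 1 + numHooks 1 rs         ≡⟨ numHooks-∷ ν↓ 1≤4 ⟨
  numHooks 1 (r ∷ rs)              ∎
  where
  open ≤-Reasoning
  Φ  = potential (gap (r ∷ rs) 0) (gap (r ∷ rs) 1)
  Φ′ = potential (gap rs 0) (gap rs 1)
  window : ℕ → ℕ
  window k = count k (armHooks 4 (gaps 4 (r ∷ rs)))
  g : ∀ i → gap (r ∷ rs) i < 4
  g = gap-<-4 ν↓ core
  step : Φ + window 3 ≤ window 1 + Φ′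
  step = stepInequality (g 0) (g 1) (g 2) (g 3) (no-4-armHook ν↓ core)
  3≤4 = s≤s (s≤s (s≤s z≤n))
  1≤4 = s≤s z≤n

partitionsBounded-descending : ∀ fuel m n → All (λ μ → AllPairs _≥_ (m ∷ μ)) (partitionsBounded fuel m n)
partitionsBounded-descending fuel       m zero    = ([] ∷ []) ∷ []
partitionsBounded-descending zero       m (suc n) = []
partitionsBounded-descending (suc fuel) m (suc n) =
  concat⁺ (map⁺ (All.map prepend (all-filter (_≤? m) (map suc (upTo (suc n))))))
  where
  prepend : ∀ {k} → k ≤ m →
            All (λ μ → AllPairs _≥_ (m ∷ μ)) (map (k ∷_) (partitionsBounded fuel k (suc n ∸ k)))
  prepend {k} k≤m = map⁺ (All.map (λ { kμ↓@(k≥μ ∷ _) → (k≤m ∷ All.map (λ μᵢ≤k → ≤-trans μᵢ≤k k≤m) k≥μ) ∷ kμ↓ })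
                                  (partitionsBounded-descending fuel k (suc n ∸ k)))

partitions-descending : ∀ n → All (AllPairs _≥_) (partitions n)
partitions-descending n = All.map (λ { (_ ∷ μ↓) → μ↓ }) (partitionsBounded-descending n n n)

theorem1p7 : (n : ℕ) → a (1 ∷ []) 4 1 n ≥ a (1 ∷ []) 4 3 n
theorem1p7 n = sum-map-mono (All.zipWith bias (all-filter selected? (partitions n) ,
                                               filter⁺ selected? (partitions-descending n)))
  where
  selected? : ∀ μ → Dec ((isCore 4 μ ∧ avoids (1 ∷ []) μ) ≡ true)
  selected? μ = (isCore 4 μ ∧ avoids (1 ∷ []) μ) Bool.≟ true
  bias : ∀ {μ} → (isCore 4 μ ∧ avoids (1 ∷ []) μ) ≡ true × AllPairs _≥_ μ → numHooks 3 μ ≤ numHooks 1 μ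
  bias (selected , μ↓) = ≤-trans (m≤n+m _ _) (hookBias μ↓ core)
    where core = proj₁ (Equivalence.to T-∧ (Equivalence.from T-≡ selected))
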